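{- Let $\Psi$ be a set of conjunctive type expressions, $E$ a type expression, $C$ a conjunctive type expression, $\Theta$ a sequence expression and $\Gamma$ a conjunctive sequence expression, and let $\rho_\Psi=\bigwedge_{C'\in\Psi}\mathrm{Empty}(C')$. (a) If $etype\_conj(C,\Psi)=\mathit{true}$ then $\rho_\Psi\models\mathrm{Empty}(C)$; (b) if $etype(E,\Psi)=\mathit{true}$ then $\rho_\Psi\models\mathrm{Empty}(E)$; (c) if $eseq\_conj(\Gamma,\Psi)=\mathit{true}$ then $\rho_\Psi\models\mathrm{Empty}(\Gamma)$; (d) if $eseq(\Theta,\Psi)=\mathit{true}$ then $\rho_\Psi\models\mathrm{Empty}(\Theta)$.
   Context: $\Sigma$ is a finite ranked alphabet of function symbols containing at least one constant; $\mathcal{T}(\Sigma)$ is the set of ground terms over $\Sigma$. $\Pi$ is a finite ranked alphabet of type constructors, disjoint from $\Sigma$ and from $\{\sqcap,\sqcup,\neg,\top,\bot\}$. A type expression is a ground term over $\Pi\cup\{\sqcap,\sqcup,\neg,\top,\bot\}$. $\Delta$ is a finite set of type rules $c(\zeta_1,\dots,\zeta_m)\rightarrow\tau$ with $c\in\Pi$ of arity $m$, distinct parameters $\zeta_i$, and $\tau$ of the form $f(\tau_1,\dots,\tau_n)$, $f\in\Sigma$, each $\tau_j$ either some $\zeta_i$ or $d(\zeta'_1,\dots,\zeta'_k)$ with $d\in\Pi$ and $\zeta'_i\in\{\zeta_1,\dots,\zeta_m\}$. $ground(\Delta)$ is the set of all instances of rules of $\Delta$ obtained by substituting type expressions for parameters,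 together with $\top\rightarrow f(\top,\dots,\top)$ for every $f\in\Sigma$. The meaning: $[\![\top]\!]_\Delta=\mathcal{T}(\Sigma)$, $[\![\bot]\!]_\Delta=\emptyset$, $\sqcap,\sqcup,\neg$ are intersection, union, complement w.r.t. $\mathcal{T}(\Sigma)$, and for a type atom $\omega$ (a type expression whose principal symbol is in $\Pi$), $[\![\omega]\!]_\Delta=\bigcup_{(\omega\rightarrow f(E_1,\dots,E_n))\in ground(\Delta)}\{f(t_1,\dots,t_n)\mid t_i\in[\![E_i]\!]_\Delta\}$. On sequences: $[\![\epsilon]\!]=\{\epsilon\}$, $[\![\langle E\rangle\bullet\theta]\!]=[\![E]\!]\times[\![\theta]\!]$, and a special sequence $\Lambda$ has $[\![\Lambda]\!]=\emptyset$; sequence expressions combine equal-length sequences with $\sqcap,\sqcup,\neg$ (set operations on tuples of terms); a conjunctive sequence expression is $\gamma_1\sqcap\dots\sqcap\gamma_k$ of sequences, with length $\|\Gamma\|$, and $\Gamma|_j=\gamma_1^j\sqcap\dots\sqcap\gamma_k^j$ ($\gamma_i^j$ the $j$-th component). $\mathrm{Empty}(O)$ means $[\![O]\!]_\Delta=\emptyset$. A literal is a type atom or its complement; a conjunctive type expression $C$ is an intersection of literals (without repetitions, containing at least one positive literal, e.g. $\top$); $pos(C)$, $neg(C)$ are its positive atoms and complemented atoms, $lit(C)$ its literals; $C_1\preceq C_2$ iff $lit(C_1)\supseteq lit(C_2)$. $\mathcal{F}(\alpha)=\{f\mid \exists (\alpha\rightarrow f(\dots))\in ground(\Delta)\}$,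 $\mathcal{A}^f_\alpha=\{\langle\alpha_1,\dots,\alpha_k\rangle\mid(\alpha\rightarrow f(\alpha_1,\dots,\alpha_k))\in ground(\Delta)\}$. $push(\neg(\sqcup_i\gamma_i))=\sqcap_i push(\neg\gamma_i)$, $push(\neg\langle E_1,\dots,E_k\rangle)=\sqcup_{l=1}^k\langle\top,\dots,\top,\neg E_l,\top,\dots,\top\rangle$ ($\neg E_l$ at position $l$), $push(\neg\epsilon)=\Lambda$. $\mathcal{B}^f_C=\big(\sqcap_{\omega\in pos(C)}(\sqcup\mathcal{A}^f_\omega)\big)\sqcap\big(\sqcap_{\tau\in neg(C)}push(\neg(\sqcup\mathcal{A}^f_\tau))\big)$. DNF denotes disjunctive normal form (set of disjuncts). The algorithm: $etype(E)=etype(E,\emptyset)$; $etype(E,\Psi)=\forall C\in DNF(E).\,etype\_conj(C,\Psi)$; $etype\_conj(C,\Psi)=\mathit{true}$ if $pos(C)\cap neg(C)\neq\emptyset$, $\mathit{true}$ if $\exists C'\in\Psi.\,C\preceq C'$, otherwise $\forall f\in\bigcap_{\alpha\in pos(C)}\mathcal{F}(\alpha).\,eseq(\mathcal{B}^f_C,\Psi\cup\{C\})$; $eseq(\Theta,\Psi)=\forall\Gamma\in DNF(\Theta).\,eseq\_conj(\Gamma,\Psi)$; $eseq\_conj(\Gamma,\Psi)$ is $\mathit{true}$ if $\|\Gamma\|=0$ and $\Lambda\in\Gamma$, $\mathit{false}$ if $\|\Gamma\|=0$ and $\Lambda\notin\Gamma$, and $\exists 1\le j\le\|\Gamma\|.\,etype(\Gamma|_j,\Psi)$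 otherwise. -}

module Defs where

open import Data.Nat using (ℕ; zero; suc) renaming (_≡ᵇ_ to _≡ᵇℕ_)
open import Data.Fin using (Fin; toℕ)
open import Data.Fin.Properties using () renaming (_≟_ to _≟Fin_)
open import Data.Vec using (Vec; []; _∷_; lookup; replicate; _[_]≔_)
import Data.Vec as Vec
open import Data.List using (List; []; _∷_; _++_; map; concatMap; allFin; deduplicate)
open import Data.Bool.ListAction using (any)
open import Data.List.Membership.Propositional using (_∈_)
open import Data.List.Relation.Unary.All using (All)
open import Data.List.Relation.Unary.Any using (Any)
open import Data.List.Relation.Binary.Subset.Propositional using (_⊆_)
open import Data.List.Relation.Unary.Unique.Propositional using (Unique)
open import Data.Bool using (Bool; true; false; _∧_; T; if_then_else_)
open import Data.Product using (Σ; ∃; ∃₂; _×_; _,_)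
open import Data.Sum using (_⊎_)
open import Data.Unit using () renaming (⊤ to Unit)
open import Data.Empty using (⊥)
open import Relation.Nullary using (¬_; yes; no)
open import Relation.Nullary.Decidable using (T?)
open import Relation.Binary.PropositionalEquality using (_≡_; refl)

-- Signature: finite ranked alphabets Σ (function symbols) and Π (type
-- constructors).  Disjointness from each
-- other and from {⊓,⊔,¬,⊤,⊥} is automatic (different syntactic classes).

record Sig : Set where
  field
    nΣ       : ℕ
    arΣ      : Fin nΣ → ℕ
    hasConst : ∃ λ (f : Fin nΣ) → arΣ f ≡ 0
    nΠ       : ℕ
    arΠ      : Fin nΠ → ℕ

module Types (S : Sig) where
  open Sig S

  infixr 7 _⊓_
  infixr 6 _⊔_
  data TExp : Set where
    ⊤ᵗ ⊥ᵗ : TExp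
    _⊓_ _⊔_ : TExp → TExp → TExp
    ¬ᵗ : TExp → TExp
    atom : (c : Fin nΠ) → Vec TExp (arΠ c) → TExp

  data Term : Set where
    app : (f : Fin nΣ) → Vec Term (arΣ f) → Term

  -- argument τ_j of the right-hand side of a type rule for a constructor
  -- of arity m: a parameter ζ_i (i : Fin m) or d(ζ'_1,…,ζ'_k)
  data Arg (m : ℕ) : Set where
    par : Fin m → Arg m
    con : (d : Fin nΠ) → Vec (Fin m) (arΠ d) → Arg m

  -- a type rule  c(ζ_1,…,ζ_m) → f(τ_1,…,τ_n)  (parameters ζ_i are the
  -- distinct indices i : Fin m)
  record Rule (c : Fin nΠ) : Set where
    field
      sym  : Fin nΣ
      args : Vec (Arg (arΠ c)) (arΣ sym)

  RuleSet : Set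
  RuleSet = (c : Fin nΠ) → List (Rule c)

  inst : ∀ {m} → Vec TExp m → Arg m → TExp
  inst σ (par i)   = lookup σ i
  inst σ (con d ζ) = atom d (Vec.map (lookup σ) ζ)

  data Lit : Set where
    ptop  : Lit
    patom : (c : Fin nΠ) → Vec TExp (arΠ c) → Lit
    natom : (c : Fin nΠ) → Vec TExp (arΠ c) → Lit

  -- conjunctive type expression = (list of) its literals
  Conj : Set
  Conj = List Lit

  isPos : Lit → Bool
  isPos (natom _ _) = false
  isPos _           = true

  WFConj : Conj → Set
  WFConj C = Unique C × Any (λ l → T (isPos l)) C

  posL : Conj → List TExp
  posL []                = []
  posL (ptop ∷ C)        = ⊤ᵗ ∷ posL C
  posL (patom c σ ∷ C)   = atom c σ ∷ posL C
  posL (natom _ _ ∷ C)   = posL C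

  negL : Conj → List TExp
  negL []                = []
  negL (natom c σ ∷ C)   = atom c σ ∷ negL C
  negL (_ ∷ C)           = negL C

  _⪯_ : Conj → Conj → Set
  C₁ ⪯ C₂ = C₂ ⊆ C₁

  Clash : Conj → Set
  Clash C = ∃₂ λ c σ → patom c σ ∈ C × natom c σ ∈ C

  mutual
    eqT : TExp → TExp → Bool
    eqT ⊤ᵗ ⊤ᵗ = true
    eqT ⊥ᵗ ⊥ᵗ = true
    eqT (a ⊓ b) (c ⊓ d) = eqT a c ∧ eqT b d
    eqT (a ⊔ b) (c ⊔ d) = eqT a c ∧ eqT b d
    eqT (¬ᵗ a) (¬ᵗ b) = eqT a b
    eqT (atom c σ) (atom d τ) = (toℕ c ≡ᵇℕ toℕ d) ∧ eqV σ τ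
    eqT _ _ = false

    eqV : ∀ {n m} → Vec TExp n → Vec TExp m → Bool
    eqV [] [] = true
    eqV (x ∷ xs) (y ∷ ys) = eqT x y ∧ eqV xs ys
    eqV _ _ = false

  eqL : Lit → Lit → Bool
  eqL ptop ptop = true
  eqL (patom c σ) (patom d τ) = eqT (atom c σ) (atom d τ)
  eqL (natom c σ) (natom d τ) = eqT (atom c σ) (atom d τ)
  eqL _ _ = false

  cross : ∀ {A : Set} → List (List A) → List (List A) → List (List A)
  cross xs ys = concatMap (λ c → map (λ d → c ++ d) ys) xs

  mutual
    dnf : TExp → List Conj
    dnf ⊤ᵗ = [] ∷ []
    dnf ⊥ᵗ = []
    dnf (E ⊓ F) = cross (dnf E) (dnf F)
    dnf (E ⊔ F) = dnf E ++ dnf F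
    dnf (¬ᵗ E) = dnfNeg E
    dnf (atom c σ) = (patom c σ ∷ []) ∷ []

    dnfNeg : TExp → List Conj
    dnfNeg ⊤ᵗ = []
    dnfNeg ⊥ᵗ = [] ∷ []
    dnfNeg (E ⊓ F) = dnfNeg E ++ dnfNeg F
    dnfNeg (E ⊔ F) = cross (dnfNeg E) (dnfNeg F)
    dnfNeg (¬ᵗ E) = dnf E
    dnfNeg (atom c σ) = (natom c σ ∷ []) ∷ []

  normalize : Conj → Conj
  normalize C with deduplicate (λ x y → T? (eqL x y)) C
  ... | C' = if any isPos C' then C' else ptop ∷ C'

  DNF : TExp → List Conj
  DNF E = map normalize (dnf E)

  data SExp : ℕ → Set where
    Λ  : SExp 0
    sq : ∀ {n} → Vec TExp n → SExp n
    ⋀ ⋁ : ∀ {n} → List (SExp n) → SExp n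
    ¬ˢ : ∀ {n} → SExp n → SExp n

  data SAtom : ℕ → Set where
    Λᵃ  : SAtom 0
    sqᵃ : ∀ {n} → Vec TExp n → SAtom n

  -- conjunctive sequence expression  γ₁ ⊓ … ⊓ γ_k  (as list of the γ_i)
  CSeq : ℕ → Set
  CSeq n = List (SAtom n)

  negAt : ∀ {n} → Vec TExp n → Fin n → Vec TExp n
  negAt {n} Es l = replicate n ⊤ᵗ [ l ]≔ ¬ᵗ (lookup Es l)

  pushNegSeq : ∀ {n} → Vec TExp n → SExp n
  pushNegSeq {zero}  []  = Λ
  pushNegSeq {suc n} Es  = ⋁ (map (λ l → sq (negAt Es l)) (allFin (suc n)))

  pushNegOr : ∀ {n} → List (Vec TExp n) → SExp n
  pushNegOr γs = ⋀ (map pushNegSeq γs)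

  -- DNF of push(¬⟨E₁,…,E_k⟩) (computed directly, = dnfS (pushNegSeq Es))
  dnfNegSeq : ∀ {n} → Vec TExp n → List (CSeq n)
  dnfNegSeq {zero}  [] = (Λᵃ ∷ []) ∷ []
  dnfNegSeq {suc n} Es = map (λ l → sqᵃ (negAt Es l) ∷ []) (allFin (suc n))

  mutual
    dnfS : ∀ {n} → SExp n → List (CSeq n)
    dnfS Λ = (Λᵃ ∷ []) ∷ []
    dnfS (sq Es) = (sqᵃ Es ∷ []) ∷ []
    dnfS (⋀ xs) = dnfAnd xs
    dnfS (⋁ xs) = dnfOr xs
    dnfS (¬ˢ x) = dnfSNeg x

    dnfAnd : ∀ {n} → List (SExp n) → List (CSeq n)
    dnfAnd [] = [] ∷ []
    dnfAnd (x ∷ xs) = cross (dnfS x) (dnfAnd xs)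

    dnfOr : ∀ {n} → List (SExp n) → List (CSeq n)
    dnfOr [] = []
    dnfOr (x ∷ xs) = dnfS x ++ dnfOr xs

    dnfSNeg : ∀ {n} → SExp n → List (CSeq n)
    dnfSNeg Λ = (sqᵃ [] ∷ []) ∷ []
    dnfSNeg (sq Es) = dnfNegSeq Es
    dnfSNeg (⋀ xs) = dnfNegAnd xs
    dnfSNeg (⋁ xs) = dnfNegOr xs
    dnfSNeg (¬ˢ x) = dnfS x

    dnfNegAnd : ∀ {n} → List (SExp n) → List (CSeq n)
    dnfNegAnd [] = []
    dnfNegAnd (x ∷ xs) = dnfSNeg x ++ dnfNegAnd xs

    dnfNegOr : ∀ {n} → List (SExp n) → List (CSeq n)
    dnfNegOr [] = [] ∷ []
    dnfNegOr (x ∷ xs) = cross (dnfSNeg x) (dnfNegOr xs)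

  compA : ∀ {n} → SAtom n → Fin n → TExp
  compA (sqᵃ Es) j = lookup Es j

  conjT : List TExp → TExp
  conjT [] = ⊤ᵗ
  conjT (E ∷ []) = E
  conjT (E ∷ Es) = E ⊓ conjT Es

  _∣_ : ∀ {n} → CSeq n → Fin n → TExp
  Γ ∣ j = conjT (map (λ a → compA a j) Γ)

module Theory (S : Sig) (Δ : Types.RuleSet S) where
  open Sig S
  open Types S
  open Rule

  record GroundRule : Set where
    constructor gr
    field
      lhs : TExp
      fn  : Fin nΣ
      rhs : Vec TExp (arΣ fn)
  open GroundRule

  data InGround : GroundRule → Set where
    instRule : (c : Fin nΠ) (σ : Vec TExp (arΠ c)) (r : Rule c) → r ∈ Δ c →
               InGround (gr (atom c σ) (sym r) (Vec.map (inst σ) (args r)))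
    topRule  : (f : Fin nΣ) → InGround (gr ⊤ᵗ f (replicate (arΣ f) ⊤ᵗ))

  mutual
    _∈⟦_⟧ : Term → TExp → Set
    t ∈⟦ ⊤ᵗ ⟧ = Unit
    t ∈⟦ ⊥ᵗ ⟧ = ⊥
    t ∈⟦ E ⊓ F ⟧ = t ∈⟦ E ⟧ × t ∈⟦ F ⟧
    t ∈⟦ E ⊔ F ⟧ = t ∈⟦ E ⟧ ⊎ t ∈⟦ F ⟧
    t ∈⟦ ¬ᵗ E ⟧ = ¬ (t ∈⟦ E ⟧)
    app f ts ∈⟦ atom c σ ⟧ =
      Σ GroundRule λ g → InGround g × lhs g ≡ atom c σ × fn g ≡ f × ts ∈⟦ rhs g ⟧ᵛ

    _∈⟦_⟧ᵛ : ∀ {n m} → Vec Term n → Vec TExp m → Set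
    [] ∈⟦ [] ⟧ᵛ = Unit
    (t ∷ ts) ∈⟦ E ∷ Es ⟧ᵛ = t ∈⟦ E ⟧ × ts ∈⟦ Es ⟧ᵛ
    _ ∈⟦ _ ⟧ᵛ = ⊥

  memLit : Term → Lit → Set
  memLit t ptop = Unit
  memLit t (patom c σ) = t ∈⟦ atom c σ ⟧
  memLit t (natom c σ) = ¬ (t ∈⟦ atom c σ ⟧)

  _∈⟦_⟧ᶜ : Term → Conj → Set
  t ∈⟦ C ⟧ᶜ = All (memLit t) C

  mutual
    _∈⟦_⟧ˢ : ∀ {n} → Vec Term n → SExp n → Set
    ts ∈⟦ Λ ⟧ˢ = ⊥
    ts ∈⟦ sq Es ⟧ˢ = ts ∈⟦ Es ⟧ᵛ
    ts ∈⟦ ⋀ xs ⟧ˢ = memAll ts xs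
    ts ∈⟦ ⋁ xs ⟧ˢ = memAny ts xs
    ts ∈⟦ ¬ˢ x ⟧ˢ = ¬ (ts ∈⟦ x ⟧ˢ)

    memAll : ∀ {n} → Vec Term n → List (SExp n) → Set
    memAll ts [] = Unit
    memAll ts (x ∷ xs) = ts ∈⟦ x ⟧ˢ × memAll ts xs

    memAny : ∀ {n} → Vec Term n → List (SExp n) → Set
    memAny ts [] = ⊥
    memAny ts (x ∷ xs) = ts ∈⟦ x ⟧ˢ ⊎ memAny ts xs

  memSA : ∀ {n} → Vec Term n → SAtom n → Set
  memSA ts Λᵃ = ⊥
  memSA ts (sqᵃ Es) = ts ∈⟦ Es ⟧ᵛ

  _∈⟦_⟧ᵍ : ∀ {n} → Vec Term n → CSeq n → Set
  ts ∈⟦ Γ ⟧ᵍ = All (memSA ts) Γ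

  EmptyT : TExp → Set
  EmptyT E = ∀ t → ¬ (t ∈⟦ E ⟧)

  EmptyC : Conj → Set
  EmptyC C = ∀ t → ¬ (t ∈⟦ C ⟧ᶜ)

  EmptyS : ∀ {n} → SExp n → Set
  EmptyS Θ = ∀ ts → ¬ (ts ∈⟦ Θ ⟧ˢ)

  EmptyΓ : ∀ {n} → CSeq n → Set
  EmptyΓ Γ = ∀ ts → ¬ (ts ∈⟦ Γ ⟧ᵍ)

  ρ : List Conj → Set
  ρ Ψ = All EmptyC Ψ

  InF : Fin nΣ → TExp → Set
  InF f α = Σ GroundRule λ g → InGround g × lhs g ≡ α × fn g ≡ f

  -- 𝓐^f_α (computed from Δ; agrees with the ground(Δ) definition)
  selectF : ∀ {c} (f : Fin nΣ) → Vec TExp (arΠ c) → Rule c → List (Vec TExp (arΣ f))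
  selectF f σ r with sym r ≟Fin f
  ... | yes refl = Vec.map (inst σ) (args r) ∷ []
  ... | no _     = []

  𝓐 : (f : Fin nΣ) → TExp → List (Vec TExp (arΣ f))
  𝓐 f ⊤ᵗ = replicate (arΣ f) ⊤ᵗ ∷ []
  𝓐 f (atom c σ) = concatMap (selectF f σ) (Δ c)
  𝓐 f _ = []

  𝓑 : (f : Fin nΣ) → Conj → SExp (arΣ f)
  𝓑 f C = ⋀ (map (λ ω → ⋁ (map sq (𝓐 f ω))) (posL C)
             ++ map (λ τ → pushNegOr (𝓐 f τ)) (negL C))

  Feasible : Fin nΣ → Conj → Set
  Feasible f C = ∀ α → α ∈ posL C → InF f α

  Subsumed : List Conj → Conj → Set
  Subsumed Ψ C = ∃ λ C' → C' ∈ Ψ × C ⪯ C'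

  -- the algorithm, as the inductive relation "returns true"
  mutual
    data ETypeConj : List Conj → Conj → Set where
      clash    : ∀ {Ψ C} → Clash C → ETypeConj Ψ C
      subsumed : ∀ {Ψ C} → Subsumed Ψ C → ETypeConj Ψ C
      expand   : ∀ {Ψ C} → ¬ Clash C → ¬ Subsumed Ψ C →
                 ((f : Fin nΣ) → Feasible f C →
                    All (ESeqConj (C ∷ Ψ)) (dnfS (𝓑 f C))) →
                 ETypeConj Ψ C

    data ESeqConj : List Conj → ∀ {n} → CSeq n → Set where
      lam  : ∀ {Ψ} {Γ : CSeq 0} → Λᵃ ∈ Γ → ESeqConj Ψ Γ
      comp : ∀ {Ψ n} {Γ : CSeq (suc n)} (j : Fin (suc n)) →
             All (ETypeConj Ψ) (DNF (Γ ∣ j)) → ESeqConj Ψ Γ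

  EType : List Conj → TExp → Set
  EType Ψ E = All (ETypeConj Ψ) (DNF E)

  ESeq : List Conj → ∀ {n} → SExp n → Set
  ESeq Ψ Θ = All (ESeqConj Ψ) (dnfS Θ)

{-# OPTIONS --safe #-}
module Submission where

-- Soundness is proved by induction on the depth of a would-be witness.  A
-- term t = f(ts) in a conjunction C forces f ∈ ⋂ 𝓕(α) over pos(C) and (up to
-- double negation) ts ∈ 𝓑^f_C, so refuting every disjunct of 𝓑^f_C refutes t.
-- The assumption Empty(C) added to Ψ by the recursive call is only consulted
-- on the arguments ts, which are strictly shallower than t, and for those it
-- is the induction hypothesis.  Complements are constructive negations, so
-- the DNF transformations are sound only up to double negation; this is
-- enough, since every conclusion is itself a negation.

open import Defs
open import Level using (0ℓ)
open import Function using (_∘_)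
open import Data.Nat using (ℕ; zero; suc; _≤_; s≤s) renaming (_⊔_ to _⊔ℕ_)
open import Data.Nat.Properties using (≤-refl; ≤-trans; n≤1+n; m≤m⊔n; m≤n⊔m)
open import Data.Fin using () renaming (zero to fzero; suc to fsuc)
open import Data.Fin.Properties using () renaming (_≟_ to _≟Fin_)
open import Data.Vec using (Vec; []; _∷_; lookup; replicate)
import Data.Vec as Vec
open import Data.List using (List; []; _∷_; _++_; map; deduplicate)
open import Data.List.Relation.Unary.All using (All; []; _∷_)
import Data.List.Relation.Unary.All as All
import Data.List.Relation.Unary.All.Properties as All
open import Data.List.Relation.Unary.Any using (Any; here; there)
import Data.List.Relation.Unary.Any as Any
import Data.List.Relation.Unary.Any.Properties as Any
open import Data.List.Membership.Propositional using (_∈_; find; lose)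
open import Data.List.Membership.Propositional.Properties using (∈-allFin)
open import Data.Bool using (true; false; if_then_else_)
open import Data.Bool.ListAction using (any)
open import Data.Product using (∃; _×_; _,_)
open import Data.Sum using (inj₁; inj₂)
open import Data.Unit using (tt)
open import Relation.Nullary using (¬_; yes; no)
open import Relation.Nullary.Negation using (¬¬-Monad; ¬¬-map; contradiction)
open import Relation.Nullary.Decidable using (T?)
open import Relation.Binary.PropositionalEquality using (_≡_; refl)

module Soundness (S : Sig) (Δ : Types.RuleSet S) where
  open Sig S
  open Types S
  open Theory S Δ
  open Rule

  ¬¬-All : ∀ {A : Set} {P : A → Set} {xs} → All (λ x → ¬ ¬ P x) xs → ¬ ¬ All P xs
  ¬¬-All = All.sequenceM 0ℓ ¬¬-Monad

  Any-cross⁺ : ∀ {A : Set} {Q : A → Set} {xs ys : List (List A)} →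
               Any (All Q) xs → Any (All Q) ys → Any (All Q) (cross xs ys)
  Any-cross⁺ {ys = ys} (here qx) qys = Any.++⁺ˡ (Any.map⁺ (Any.map (All.++⁺ qx) qys))
  Any-cross⁺ {xs = x ∷ _} {ys} (there qxs) qys =
    Any.++⁺ʳ (map (x ++_) ys) (Any-cross⁺ qxs qys)

  mutual
    dnf-sound : ∀ {t} E → ¬ Any (t ∈⟦_⟧ᶜ) (dnf E) → ¬ t ∈⟦ E ⟧
    dnf-sound ⊤ᵗ         ∉dnf _        = ∉dnf (here [])
    dnf-sound ⊥ᵗ         _    ()
    dnf-sound (E ⊓ F)    ∉dnf (e , f)  =
      dnf-sound E (λ inE → dnf-sound F (λ inF → ∉dnf (Any-cross⁺ inE inF)) f) e
    dnf-sound (E ⊔ F)    ∉dnf (inj₁ e) = dnf-sound E (∉dnf ∘ Any.++⁺ˡ) e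
    dnf-sound (E ⊔ F)    ∉dnf (inj₂ f) = dnf-sound F (∉dnf ∘ Any.++⁺ʳ (dnf E)) f
    dnf-sound (¬ᵗ E)     ∉dnf ∉E       = dnfNeg-sound E ∉dnf ∉E
    dnf-sound (atom c σ) ∉dnf t∈       = ∉dnf (here (t∈ ∷ []))

    dnfNeg-sound : ∀ {t} E → ¬ Any (t ∈⟦_⟧ᶜ) (dnfNeg E) → ¬ ¬ t ∈⟦ E ⟧
    dnfNeg-sound ⊤ᵗ         _    ∉E   = ∉E tt
    dnfNeg-sound ⊥ᵗ         ∉dnf _    = ∉dnf (here [])
    dnfNeg-sound (E ⊓ F)    ∉dnf ∉EF  =
      dnfNeg-sound E (∉dnf ∘ Any.++⁺ˡ) λ e →
      dnfNeg-sound F (∉dnf ∘ Any.++⁺ʳ (dnfNeg E)) λ f → ∉EF (e , f)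
    dnfNeg-sound (E ⊔ F)    ∉dnf ∉EF  =
      dnfNeg-sound E (λ inE → dnfNeg-sound F (λ inF → ∉dnf (Any-cross⁺ inE inF)) (∉EF ∘ inj₂))
                     (∉EF ∘ inj₁)
    dnfNeg-sound (¬ᵗ E)     ∉dnf ∉¬E  = ∉¬E (dnf-sound E ∉dnf)
    dnfNeg-sound (atom c σ) ∉dnf ∉E   = ∉dnf (here (∉E ∷ []))

  ∈-normalize : ∀ {t} C → t ∈⟦ C ⟧ᶜ → t ∈⟦ normalize C ⟧ᶜ
  ∈-normalize C t∈ = add-⊤ (any isPos C′) (All.deduplicate⁺ _ t∈)
    where
      C′ : Conj
      C′ = deduplicate (λ x y → T? (eqL x y)) C
      add-⊤ : ∀ {t} b → t ∈⟦ C′ ⟧ᶜ → t ∈⟦ if b then C′ else ptop ∷ C′ ⟧ᶜ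
      add-⊤ true  t∈ = t∈
      add-⊤ false t∈ = tt ∷ t∈

  DNF-sound : ∀ {t} E → ¬ Any (t ∈⟦_⟧ᶜ) (DNF E) → ¬ t ∈⟦ E ⟧
  DNF-sound E ∉DNF = dnf-sound E (∉DNF ∘ Any.map⁺ ∘ Any.map (∈-normalize _))

  memAll⁺ : ∀ {n} {ts : Vec Term n} {Θs} → All (ts ∈⟦_⟧ˢ) Θs → memAll ts Θs
  memAll⁺ []         = tt
  memAll⁺ (m ∷ ms)   = m , memAll⁺ ms

  memAny⁺ : ∀ {n} {ts : Vec Term n} {Θs} → Any (ts ∈⟦_⟧ˢ) Θs → memAny ts Θs
  memAny⁺ (here m)   = inj₁ m
  memAny⁺ (there ms) = inj₂ (memAny⁺ ms)

  ∈-replicate-⊤ : ∀ {n} (ts : Vec Term n) → ts ∈⟦ replicate n ⊤ᵗ ⟧ᵛ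
  ∈-replicate-⊤ []       = tt
  ∈-replicate-⊤ (t ∷ ts) = tt , ∈-replicate-⊤ ts

  ∉ᵛ⇒¬¬∈negAt : ∀ {n} {ts : Vec Term n} (Es : Vec TExp n) →
                ¬ ts ∈⟦ Es ⟧ᵛ → ¬ ¬ ∃ λ l → ts ∈⟦ negAt Es l ⟧ᵛ
  ∉ᵛ⇒¬¬∈negAt {ts = []}     []       ∉Es _ = ∉Es tt
  ∉ᵛ⇒¬¬∈negAt {ts = t ∷ ts} (E ∷ Es) ∉Es k =
    ∉ᵛ⇒¬¬∈negAt Es (λ ts∈ → k (fzero , (λ t∈ → ∉Es (t∈ , ts∈)) , ∈-replicate-⊤ ts))
                   (λ (l , ts∈) → k (fsuc l , tt , ts∈))

  dnfNegSeq-sound : ∀ {n} {ts : Vec Term n} (Es : Vec TExp n) →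
                    ¬ Any (ts ∈⟦_⟧ᵍ) (dnfNegSeq Es) → ¬ ¬ ts ∈⟦ Es ⟧ᵛ
  dnfNegSeq-sound {zero}  {[]} [] _ ∉Es = ∉Es tt
  dnfNegSeq-sound {suc n} Es ∉dnf ∉Es =
    ∉ᵛ⇒¬¬∈negAt Es ∉Es λ (l , ts∈) → ∉dnf (Any.map⁺ (lose (∈-allFin l) (ts∈ ∷ [])))

  pushNegSeq-complete : ∀ {n} {ts : Vec Term n} (Es : Vec TExp n) →
                        ¬ ts ∈⟦ Es ⟧ᵛ → ¬ ¬ ts ∈⟦ pushNegSeq Es ⟧ˢ
  pushNegSeq-complete {zero}  {[]} [] ∉Es _ = ∉Es tt
  pushNegSeq-complete {suc n} Es ∉Es k =
    ∉ᵛ⇒¬¬∈negAt Es ∉Es λ (l , ts∈) → k (memAny⁺ (Any.map⁺ (lose (∈-allFin l) ts∈)))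

  pushNegOr-complete : ∀ {n} {ts : Vec Term n} (As : List (Vec TExp n)) →
                       ¬ Any (ts ∈⟦_⟧ᵛ) As → ¬ ¬ ts ∈⟦ pushNegOr As ⟧ˢ
  pushNegOr-complete As ∉As =
    ¬¬-map (memAll⁺ ∘ All.map⁺)
           (¬¬-All (All.map (λ {Es} → pushNegSeq-complete Es) (All.¬Any⇒All¬ As ∉As)))

  mutual
    dnfS-sound : ∀ {n} {ts : Vec Term n} Θ → ¬ Any (ts ∈⟦_⟧ᵍ) (dnfS Θ) → ¬ ts ∈⟦ Θ ⟧ˢ
    dnfS-sound Λ       _    ()
    dnfS-sound (sq Es) ∉dnf ts∈ = ∉dnf (here (ts∈ ∷ []))
    dnfS-sound (⋀ Θs)  ∉dnf ts∈ = dnfAnd-sound Θs ∉dnf ts∈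
    dnfS-sound (⋁ Θs)  ∉dnf ts∈ = dnfOr-sound Θs ∉dnf ts∈
    dnfS-sound (¬ˢ Θ)  ∉dnf ∉Θ  = dnfSNeg-sound Θ ∉dnf ∉Θ

    dnfAnd-sound : ∀ {n} {ts : Vec Term n} Θs →
                   ¬ Any (ts ∈⟦_⟧ᵍ) (dnfAnd Θs) → ¬ memAll ts Θs
    dnfAnd-sound []       ∉dnf _ = ∉dnf (here [])
    dnfAnd-sound (Θ ∷ Θs) ∉dnf (ts∈ , ts∈s) =
      dnfS-sound Θ (λ inΘ → dnfAnd-sound Θs (λ inΘs → ∉dnf (Any-cross⁺ inΘ inΘs)) ts∈s) ts∈

    dnfOr-sound : ∀ {n} {ts : Vec Term n} Θs →
                  ¬ Any (ts ∈⟦_⟧ᵍ) (dnfOr Θs) → ¬ memAny ts Θs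
    dnfOr-sound []       _    ()
    dnfOr-sound (Θ ∷ Θs) ∉dnf (inj₁ ts∈) = dnfS-sound Θ (∉dnf ∘ Any.++⁺ˡ) ts∈
    dnfOr-sound (Θ ∷ Θs) ∉dnf (inj₂ ts∈) = dnfOr-sound Θs (∉dnf ∘ Any.++⁺ʳ (dnfS Θ)) ts∈

    dnfSNeg-sound : ∀ {n} {ts : Vec Term n} Θ →
                    ¬ Any (ts ∈⟦_⟧ᵍ) (dnfSNeg Θ) → ¬ ¬ ts ∈⟦ Θ ⟧ˢ
    dnfSNeg-sound {ts = []} Λ ∉dnf _ = ∉dnf (here (tt ∷ []))
    dnfSNeg-sound (sq Es) ∉dnf ∉Θ  = dnfNegSeq-sound Es ∉dnf ∉Θ
    dnfSNeg-sound (⋀ Θs)  ∉dnf ∉Θ  = dnfNegAnd-sound Θs ∉dnf ∉Θ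
    dnfSNeg-sound (⋁ Θs)  ∉dnf ∉Θ  = dnfNegOr-sound Θs ∉dnf ∉Θ
    dnfSNeg-sound (¬ˢ Θ)  ∉dnf ∉¬Θ = ∉¬Θ (dnfS-sound Θ ∉dnf)

    dnfNegAnd-sound : ∀ {n} {ts : Vec Term n} Θs →
                      ¬ Any (ts ∈⟦_⟧ᵍ) (dnfNegAnd Θs) → ¬ ¬ memAll ts Θs
    dnfNegAnd-sound []       ∉dnf ∉Θs = ∉Θs tt
    dnfNegAnd-sound (Θ ∷ Θs) ∉dnf ∉Θs =
      dnfSNeg-sound Θ (∉dnf ∘ Any.++⁺ˡ) λ ts∈ →
      dnfNegAnd-sound Θs (∉dnf ∘ Any.++⁺ʳ (dnfSNeg Θ)) λ ts∈s → ∉Θs (ts∈ , ts∈s)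

    dnfNegOr-sound : ∀ {n} {ts : Vec Term n} Θs →
                     ¬ Any (ts ∈⟦_⟧ᵍ) (dnfNegOr Θs) → ¬ ¬ memAny ts Θs
    dnfNegOr-sound []       ∉dnf _   = ∉dnf (here [])
    dnfNegOr-sound (Θ ∷ Θs) ∉dnf ∉Θs =
      dnfSNeg-sound Θ (λ inΘ → dnfNegOr-sound Θs (λ inΘs → ∉dnf (Any-cross⁺ inΘ inΘs))
                                                 (∉Θs ∘ inj₂))
                      (∉Θs ∘ inj₁)

  selectF-complete : ∀ {c f} {σ : Vec TExp (arΠ c)} {ts : Vec Term (arΣ f)} (r : Rule c) →
                     sym r ≡ f → ts ∈⟦ Vec.map (inst σ) (args r) ⟧ᵛ →
                     Any (ts ∈⟦_⟧ᵛ) (selectF f σ r)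
  selectF-complete {f = f} r sym≡f ts∈ with sym r ≟Fin f
  ... | yes refl = here ts∈
  ... | no sym≢f = contradiction sym≡f sym≢f

  selectF-sound : ∀ {c f} {σ : Vec TExp (arΠ c)} {ts : Vec Term (arΣ f)} {r : Rule c} →
                  r ∈ Δ c → Any (ts ∈⟦_⟧ᵛ) (selectF f σ r) → app f ts ∈⟦ atom c σ ⟧
  selectF-sound {c} {f} {σ} {r = r} r∈Δ inSel with sym r ≟Fin f | inSel
  ... | yes refl | here ts∈ = gr _ _ _ , instRule c σ r r∈Δ , refl , refl , ts∈

  𝓐-complete : ∀ {c f} {σ : Vec TExp (arΠ c)} {ts : Vec Term (arΣ f)} →
               app f ts ∈⟦ atom c σ ⟧ → Any (ts ∈⟦_⟧ᵛ) (𝓐 f (atom c σ))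
  𝓐-complete (_ , instRule _ _ r r∈Δ , refl , sym≡f , ts∈) =
    Any.concatMap⁺ _ (lose r∈Δ (selectF-complete r sym≡f ts∈))

  𝓐-sound : ∀ {c f} {σ : Vec TExp (arΠ c)} {ts : Vec Term (arΣ f)} →
            Any (ts ∈⟦_⟧ᵛ) (𝓐 f (atom c σ)) → app f ts ∈⟦ atom c σ ⟧
  𝓐-sound {c} {f} {σ} in𝓐 =
    let _ , r∈Δ , inSel = find (Any.concatMap⁻ (selectF f σ) {xs = Δ c} in𝓐)
    in selectF-sound r∈Δ inSel

  All-posL⁺ : ∀ {t} {P : TExp → Set} → P ⊤ᵗ → (∀ {c σ} → t ∈⟦ atom c σ ⟧ → P (atom c σ)) →
              ∀ C → t ∈⟦ C ⟧ᶜ → All P (posL C)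
  All-posL⁺ p⊤ pat []              []          = []
  All-posL⁺ p⊤ pat (ptop ∷ C)      (_   ∷ t∈C) = p⊤ ∷ All-posL⁺ p⊤ pat C t∈C
  All-posL⁺ p⊤ pat (patom c σ ∷ C) (t∈a ∷ t∈C) = pat t∈a ∷ All-posL⁺ p⊤ pat C t∈C
  All-posL⁺ p⊤ pat (natom c σ ∷ C) (_   ∷ t∈C) = All-posL⁺ p⊤ pat C t∈C

  All-negL⁺ : ∀ {t} {P : TExp → Set} → (∀ {c σ} → ¬ t ∈⟦ atom c σ ⟧ → P (atom c σ)) →
              ∀ C → t ∈⟦ C ⟧ᶜ → All P (negL C)
  All-negL⁺ pat []              []          = []
  All-negL⁺ pat (ptop ∷ C)      (_   ∷ t∈C) = All-negL⁺ pat C t∈C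
  All-negL⁺ pat (patom c σ ∷ C) (_   ∷ t∈C) = All-negL⁺ pat C t∈C
  All-negL⁺ pat (natom c σ ∷ C) (t∉a ∷ t∈C) = pat t∉a ∷ All-negL⁺ pat C t∈C

  feasible : ∀ {f ts} C → app f ts ∈⟦ C ⟧ᶜ → Feasible f C
  feasible {f} C t∈C α α∈pos =
    All.lookup (All-posL⁺ {P = InF f} ⊤-InF atom-InF C t∈C) α∈pos
    where
      ⊤-InF : InF f ⊤ᵗ
      ⊤-InF = gr ⊤ᵗ f (replicate _ ⊤ᵗ) , topRule f , refl , refl
      atom-InF : ∀ {c σ ts} → app f ts ∈⟦ atom c σ ⟧ → InF f (atom c σ)
      atom-InF (g , g∈ , lhs≡ , fn≡ , _) = g , g∈ , lhs≡ , fn≡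

  𝓑-complete : ∀ {f ts} C → app f ts ∈⟦ C ⟧ᶜ → ¬ ¬ ts ∈⟦ 𝓑 f C ⟧ˢ
  𝓑-complete {f} {ts} C t∈C =
    ¬¬-map (λ inNeg → memAll⁺ (All.++⁺ (All.map⁺ inPos) (All.map⁺ inNeg))) (¬¬-All ¬¬inNeg)
    where
      inPos : All (λ ω → ts ∈⟦ ⋁ (map sq (𝓐 f ω)) ⟧ˢ) (posL C)
      inPos = All.map (memAny⁺ ∘ Any.map⁺)
                      (All-posL⁺ (here (∈-replicate-⊤ ts)) 𝓐-complete C t∈C)
      ¬¬inNeg : All (λ τ → ¬ ¬ ts ∈⟦ pushNegOr (𝓐 f τ) ⟧ˢ) (negL C)
      ¬¬inNeg = All-negL⁺ (λ t∉a → pushNegOr-complete _ (t∉a ∘ 𝓐-sound)) C t∈C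

  mutual
    depth : Term → ℕ
    depth (app f ts) = suc (depths ts)

    depths : ∀ {n} → Vec Term n → ℕ
    depths []       = 0
    depths (t ∷ ts) = depth t ⊔ℕ depths ts

  depth-lookup≤depths : ∀ {n} (ts : Vec Term n) j → depth (lookup ts j) ≤ depths ts
  depth-lookup≤depths (t ∷ ts) fzero    = m≤m⊔n (depth t) (depths ts)
  depth-lookup≤depths (t ∷ ts) (fsuc j) =
    ≤-trans (depth-lookup≤depths ts j) (m≤n⊔m (depth t) (depths ts))

  ∈ᵛ-lookup : ∀ {n} {ts : Vec Term n} {Es : Vec TExp n} j →
              ts ∈⟦ Es ⟧ᵛ → lookup ts j ∈⟦ lookup Es j ⟧
  ∈ᵛ-lookup {ts = _ ∷ _} {_ ∷ _} fzero    (t∈ , _)   = t∈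
  ∈ᵛ-lookup {ts = _ ∷ _} {_ ∷ _} (fsuc j) (_ , ts∈) = ∈ᵛ-lookup j ts∈

  ∈-conjT : ∀ {t} Es → All (t ∈⟦_⟧) Es → t ∈⟦ conjT Es ⟧
  ∈-conjT []           []         = tt
  ∈-conjT (E ∷ [])     (t∈ ∷ [])  = t∈
  ∈-conjT (E ∷ F ∷ Es) (t∈ ∷ t∈s) = t∈ , ∈-conjT (F ∷ Es) t∈s

  ∈-component : ∀ {n} {ts : Vec Term (suc n)} (Γ : CSeq (suc n)) j →
                ts ∈⟦ Γ ⟧ᵍ → lookup ts j ∈⟦ Γ ∣ j ⟧
  ∈-component {ts = ts} Γ j ts∈Γ = ∈-conjT _ (All.map⁺ (All.map (λ {a} → ∈-compA a) ts∈Γ))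
    where
      ∈-compA : ∀ a → memSA ts a → lookup ts j ∈⟦ compA a j ⟧
      ∈-compA (sqᵃ Es) = ∈ᵛ-lookup j

  EmptyUpTo : ℕ → Conj → Set
  EmptyUpTo k C = ∀ t → depth t ≤ k → ¬ t ∈⟦ C ⟧ᶜ

  ρ≤ : ℕ → List Conj → Set
  ρ≤ k = All (EmptyUpTo k)

  ρ⇒ρ≤ : ∀ {k Ψ} → ρ Ψ → ρ≤ k Ψ
  ρ⇒ρ≤ = All.map (λ empty t _ → empty t)

  ρ≤-pred : ∀ {k Ψ} → ρ≤ (suc k) Ψ → ρ≤ k Ψ
  ρ≤-pred {k} = All.map (λ empty t d → empty t (≤-trans d (n≤1+n k)))

  mutual
    etypeConj-sound≤ : ∀ k {Ψ C} → ETypeConj Ψ C → ρ≤ k Ψ → EmptyUpTo k C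
    etypeConj-sound≤ k (clash (_ , _ , p∈C , n∈C)) _ t _ t∈C =
      All.lookup t∈C n∈C (All.lookup t∈C p∈C)
    etypeConj-sound≤ k (subsumed (C′ , C′∈Ψ , C⪯C′)) ρΨ t d t∈C =
      All.lookup ρΨ C′∈Ψ t d (All.anti-mono C⪯C′ t∈C)
    etypeConj-sound≤ zero    (expand _ _ _) _ (app f ts) ()
    etypeConj-sound≤ (suc k) {Ψ} {C} C-expands@(expand _ _ 𝓑-refuted) ρΨ (app f ts) (s≤s d) t∈C =
      𝓑-complete C t∈C (eseq-sound≤ k (𝓑 f C) (𝓑-refuted f (feasible C t∈C)) ρCΨ ts d)
      where
        ρCΨ : ρ≤ k (C ∷ Ψ)
        ρCΨ = etypeConj-sound≤ k C-expands (ρ≤-pred ρΨ) ∷ ρ≤-pred ρΨ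

    eseqConj-sound≤ : ∀ k {Ψ n} {Γ : CSeq n} → ESeqConj Ψ Γ → ρ≤ k Ψ →
                      ∀ ts → depths ts ≤ k → ¬ ts ∈⟦ Γ ⟧ᵍ
    eseqConj-sound≤ k (lam Λ∈Γ) _ ts _ ts∈Γ = All.lookup ts∈Γ Λ∈Γ
    eseqConj-sound≤ k {Γ = Γ} (comp j Γ∣j-refuted) ρΨ ts d ts∈Γ =
      etype-sound≤ k (Γ ∣ j) Γ∣j-refuted ρΨ
                   (lookup ts j) (≤-trans (depth-lookup≤depths ts j) d) (∈-component Γ j ts∈Γ)

    etype-sound≤ : ∀ k {Ψ} E → EType Ψ E → ρ≤ k Ψ → ∀ t → depth t ≤ k → ¬ t ∈⟦ E ⟧
    etype-sound≤ k E DNF-refuted ρΨ t d =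
      DNF-sound E (All.All¬⇒¬Any (All.map (λ C-refuted → etypeConj-sound≤ k C-refuted ρΨ t d)
                                          DNF-refuted))

    eseq-sound≤ : ∀ k {Ψ n} (Θ : SExp n) → ESeq Ψ Θ → ρ≤ k Ψ →
                  ∀ ts → depths ts ≤ k → ¬ ts ∈⟦ Θ ⟧ˢ
    eseq-sound≤ k Θ dnf-refuted ρΨ ts d =
      dnfS-sound Θ (All.All¬⇒¬Any (All.map (λ Γ-refuted → eseqConj-sound≤ k Γ-refuted ρΨ ts d)
                                           dnf-refuted))

  etypeConj-sound : ∀ {Ψ C} → ETypeConj Ψ C → ρ Ψ → EmptyC C
  etypeConj-sound C-refuted ρΨ t = etypeConj-sound≤ (depth t) C-refuted (ρ⇒ρ≤ ρΨ) t ≤-refl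

  etype-sound : ∀ {Ψ} E → EType Ψ E → ρ Ψ → EmptyT E
  etype-sound E E-refuted ρΨ t = etype-sound≤ (depth t) E E-refuted (ρ⇒ρ≤ ρΨ) t ≤-refl

  eseqConj-sound : ∀ {Ψ n} {Γ : CSeq n} → ESeqConj Ψ Γ → ρ Ψ → EmptyΓ Γ
  eseqConj-sound Γ-refuted ρΨ ts = eseqConj-sound≤ (depths ts) Γ-refuted (ρ⇒ρ≤ ρΨ) ts ≤-refl

  eseq-sound : ∀ {Ψ n} (Θ : SExp n) → ESeq Ψ Θ → ρ Ψ → EmptyS Θ
  eseq-sound Θ Θ-refuted ρΨ ts = eseq-sound≤ (depths ts) Θ Θ-refuted (ρ⇒ρ≤ ρΨ) ts ≤-refl

lemma2 : (S : Sig) (Δ : Types.RuleSet S) →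
    let open Types S
        open Theory S Δ
    in ((Ψ : List Conj) (C : Conj) → All WFConj Ψ → WFConj C →
          ETypeConj Ψ C → ρ Ψ → EmptyC C)
     × ((Ψ : List Conj) (E : TExp) → All WFConj Ψ →
          EType Ψ E → ρ Ψ → EmptyT E)
     × ((Ψ : List Conj) {n : _} (Γ : CSeq n) → All WFConj Ψ →
          ESeqConj Ψ Γ → ρ Ψ → EmptyΓ Γ)
     × ((Ψ : List Conj) {n : _} (Θ : SExp n) → All WFConj Ψ →
          ESeq Ψ Θ → ρ Ψ → EmptyS Θ)
lemma2 S Δ = (λ _ _ _ _ → etypeConj-sound)
           , (λ _ E _ → etype-sound E)
           , (λ _ _ _ → eseqConj-sound)
           , (λ _ Θ _ → eseq-sound Θ)
  where open Soundness S Δ
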